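{- Let $\mathcal{B}^{\mathcal{E}}$ (resp. $\mathcal{B}^{\mathcal{O}}$) be the set of classes $[f]\in\mathcal{B}$ such that $f$ is mostly constant on $\mathcal{E}$ (resp. on $\mathcal{O}$). Then $|\mathcal{B}^{\mathcal{E}}\cap\mathcal{B}^{\mathcal{O}}|=e^{ -\Omega(d)}|\mathcal{B}|$, i.e. there is an absolute constant $c>0$ with $|\mathcal{B}^{\mathcal{E}}\cap\mathcal{B}^{\mathcal{O}}|\le e^{ -cd}|\mathcal{B}|$ for all sufficiently large $d$.
   Context: $Q_d$ is the Hamming cube on $V=\{0,1\}^d$ (adjacent iff differing in one coordinate); $\mathcal{E}$ (resp. $\mathcal{O}$) is the set of vertices with an even (resp. odd) number of ones. $\mathcal{A}$ is the set of all $f\colon V\to\mathbb{Z}$ with $|f(u)-f(v)|=1$ for adjacent $u,v$, and $\mathcal{B}$ is the quotient of $\mathcal{A}$ by the relation $f\equiv g$ iff $f-g$ is constant on $V$; $[f]$ is the class of $f$. A fixed absolute constant $\alpha<2$ is used to define: a set $A\subseteq V$ is small if $|A|<\alpha^d$. A function $f\in\mathcal{A}$ is mostly constant on $\mathcal{E}$ if there is $c\in\mathbb{Z}$ such that $\{v\in\mathcal{E}: f(v)\ne c\}$ is small; mostly constant on $\mathcal{O}$ is defined analogously (these notions are constant on equivalence classes). -}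

module Defs where

open import Data.Nat as ℕ using (ℕ; zero; suc; _%_)
open import Data.Integer as ℤ using (ℤ; ∣_∣; +_)
open import Data.Rational as ℚ using (ℚ; 1ℚ)
open import Data.Bool using (Bool; true; false)
open import Data.Vec using (Vec; []; _∷_)
open import Data.List using (List; []; _∷_; map; _++_; filter; length)
open import Data.Fin using (Fin)
open import Data.Product using (Σ; ∃; _×_; _,_)
open import Relation.Nullary using (¬_; Dec)
open import Relation.Nullary.Decidable using (_×-dec_; ¬?)
open import Relation.Binary.PropositionalEquality using (_≡_)

Vertex : ℕ → Set
Vertex d = Vec Bool d

allVertices : (d : ℕ) → List (Vertex d)
allVertices zero    = [] ∷ []
allVertices (suc d) = map (false ∷_) (allVertices d) ++ map (true ∷_) (allVertices d)

ones : ∀ {d} → Vertex d → ℕ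
ones []          = 0
ones (true ∷ v)  = suc (ones v)
ones (false ∷ v) = ones v

hamming : ∀ {d} → Vertex d → Vertex d → ℕ
hamming []          []          = 0
hamming (true ∷ u)  (true ∷ v)  = hamming u v
hamming (false ∷ u) (false ∷ v) = hamming u v
hamming (true ∷ u)  (false ∷ v) = suc (hamming u v)
hamming (false ∷ u) (true ∷ v)  = suc (hamming u v)

Adjacent : ∀ {d} → Vertex d → Vertex d → Set
Adjacent u v = hamming u v ≡ 1

InE : ∀ {d} → Vertex d → Set
InE v = ones v % 2 ≡ 0

InO : ∀ {d} → Vertex d → Set
InO v = ones v % 2 ≡ 1

InE? : ∀ {d} (v : Vertex d) → Dec (InE v)
InE? v = ones v % 2 ℕ.≟ 0

InO? : ∀ {d} (v : Vertex d) → Dec (InO v)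
InO? v = ones v % 2 ℕ.≟ 1

InA : (d : ℕ) → (Vertex d → ℤ) → Set
InA d f = ∀ (u v : Vertex d) → Adjacent u v → ∣ f u ℤ.- f v ∣ ≡ 1

SameClass : ∀ {d} → (Vertex d → ℤ) → (Vertex d → ℤ) → Set
SameClass {d} f g = ∃ λ (c : ℤ) → ∀ (v : Vertex d) → f v ≡ g v ℤ.+ c

_^ℚ_ : ℚ → ℕ → ℚ
q ^ℚ zero  = 1ℚ
q ^ℚ suc n = q ℚ.* (q ^ℚ n)

exceptE : (d : ℕ) → (Vertex d → ℤ) → ℤ → ℕ
exceptE d f c = length (filter (λ v → InE? v ×-dec ¬? (f v ℤ.≟ c)) (allVertices d))

exceptO : (d : ℕ) → (Vertex d → ℤ) → ℤ → ℕ
exceptO d f c = length (filter (λ v → InO? v ×-dec ¬? (f v ℤ.≟ c)) (allVertices d))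

Small : ℚ → (d : ℕ) → ℕ → Set
Small α d n = (+ n ℚ./ 1) ℚ.< (α ^ℚ d)

MostlyConstE : ℚ → (d : ℕ) → (Vertex d → ℤ) → Set
MostlyConstE α d f = ∃ λ (c : ℤ) → Small α d (exceptE d f c)

MostlyConstO : ℚ → (d : ℕ) → (Vertex d → ℤ) → Set
MostlyConstO α d f = ∃ λ (c : ℤ) → Small α d (exceptO d f c)

-- "the set of classes [f] with f satisfying P has exactly n elements":
-- an enumeration of n representatives in P, pairwise in distinct classes,
-- such that every f satisfying P lies in the class of one of them.
-- (P is meant to be invariant under SameClass.)
record NumClasses (d : ℕ) (P : (Vertex d → ℤ) → Set) (n : ℕ) : Set where
  field
    rep   : Fin n → (Vertex d → ℤ)
    repP  : ∀ i → P (rep i)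
    inj   : ∀ i j → SameClass (rep i) (rep j) → i ≡ j
    surj  : ∀ f → P f → ∃ λ i → SameClass f (rep i)

-- ℬ  and  ℬ^ℰ ∩ ℬ^𝒪 as predicates on representatives
InB : (d : ℕ) → (Vertex d → ℤ) → Set
InB d f = InA d f

InBEO : ℚ → (d : ℕ) → (Vertex d → ℤ) → Set
InBEO α d f = InA d f × MostlyConstE α d f × MostlyConstO α d f

-- Both numbers are compared through explicit codings, and one may take e^(-c) = 1/2.
-- A class in ℬ^ℰ ∩ ℬ^𝒪 has the representative f - f(0), which is 1-Lipschitz and hence takes
-- values in [-d, d]; it is determined by its constant values on ℰ and on 𝒪 together with the
-- at most L ≈ 2 α^d exceptional vertices and their values. So there are at most 2^(O(d L))
-- such classes. Conversely, the functions that vanish on ℰ and are ±1 on 𝒪 represent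
-- 2^(2^(d-1)) distinct classes of ℬ. As α < 2, d L = o(2^d), which beats the factor 2^d.
module Submission where

open import Defs

open import Data.Bool as Bool using (Bool; true; false; not)
open import Data.Empty using (⊥-elim)
open import Data.Fin as Fin using (Fin; combine; remQuot; toℕ)
open import Data.Fin.Properties as Fin using (combine-injectiveˡ; combine-injectiveʳ; combine-remQuot; remQuot-combine)
open import Data.Integer as ℤ using (ℤ; ∣_∣; +_; -[1+_]; _◃_; sign)
import Data.Integer.Properties as ℤ
open import Data.Integer.Tactic.RingSolver as ℤ-Solver using ()
open import Data.List as List using (List; filter; _++_; length)
import Data.List.Membership.Propositional as List
open import Data.List.Membership.Propositional.Properties using (∈-++⁺ˡ; ∈-++⁺ʳ; ∈-filter⁺; ∈-map⁺)
open import Data.List.Properties using (length-++)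
open import Data.List.Relation.Unary.Any using (here)
open import Data.Nat as ℕ using (ℕ; zero; suc; _≤_; _<_; _%_; z≤n; s≤s)
open import Data.Nat.Coprimality using (1-coprimeTo) renaming (sym to coprime-sym)
open import Data.Nat.DivMod using ([m+kn]%n≡m%n; m<n⇒m%n≡m; _mod_; m*n/n≡m; /-monoˡ-≤; m/n*n≤m)
import Data.Nat.Properties as ℕ
open import Data.Parity using (Parity; 0ℙ; 1ℙ; _⁻¹)
open import Data.Parity.Properties using (suc-homo-⁻¹; ⁻¹-involutive)
open import Data.Product using (∃; _×_; _,_; proj₁; proj₂)
open import Data.Rational as ℚ using (ℚ; mkℚ; 0ℚ; 1ℚ; ½; toℚᵘ; _/_)
import Data.Rational.Properties as ℚ
open import Data.Rational.Unnormalised as ℚᵘ using (ℚᵘ; mkℚᵘ; *≤*; ↥_; ↧_; ↧ₙ_)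
import Data.Rational.Unnormalised.Properties as ℚᵘ
open import Data.Sign using (Sign)
open import Data.Sum as Sum using (_⊎_; inj₁; inj₂)
open import Data.Vec as Vec using (Vec; []; _∷_; lookup; replicate; padRight; fromList)
open import Data.Vec.Membership.Propositional using (_∈_)
open import Data.Vec.Membership.Propositional.Properties using (∈-fromList⁺)
open import Data.Vec.Properties using (tabulate∘lookup; tabulate-cong; ≡-dec)
import Data.Vec.Relation.Unary.Any as VecAny
open import Function using (_∘_; Injective)
open import Relation.Binary.Definitions using (DecidableEquality)
open import Relation.Nullary using (Dec; yes; no; ¬_)
open import Relation.Nullary.Decidable using (_×-dec_; ¬?; from-yes)
open import Relation.Binary.PropositionalEquality

private variable
  A : Set
  c d k : ℕ

vertexParity : Vertex d → Parity
vertexParity = ℕ.parity ∘ ones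

parityValue : Parity → ℕ
parityValue 0ℙ = 0
parityValue 1ℙ = 1

%2≡parityValue : ∀ n → n % 2 ≡ parityValue (ℕ.parity n)
%2≡parityValue zero          = refl
%2≡parityValue (suc zero)    = refl
%2≡parityValue (suc (suc n)) = begin
  suc (suc n) % 2          ≡⟨ cong (_% 2) (ℕ.+-comm 2 n) ⟩
  (n ℕ.+ 1 ℕ.* 2) % 2      ≡⟨ [m+kn]%n≡m%n n 1 2 ⟩
  n % 2                    ≡⟨ %2≡parityValue n ⟩
  parityValue (ℕ.parity n) ∎
  where open ≡-Reasoning

even⇒InE : (v : Vertex d) → vertexParity v ≡ 0ℙ → InE v
even⇒InE v even = trans (%2≡parityValue (ones v)) (cong parityValue even)

odd⇒InO : (v : Vertex d) → vertexParity v ≡ 1ℙ → InO v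
odd⇒InO v odd = trans (%2≡parityValue (ones v)) (cong parityValue odd)

origin : Vertex d
origin = replicate _ false

origin-even : vertexParity (origin {d}) ≡ 0ℙ
origin-even {zero}  = refl
origin-even {suc d} = origin-even {d}

hamming≡0⇒≡ : (u v : Vertex d) → hamming u v ≡ 0 → u ≡ v
hamming≡0⇒≡ []          []          _ = refl
hamming≡0⇒≡ (true ∷ u)  (true ∷ v)  h = cong (true ∷_) (hamming≡0⇒≡ u v h)
hamming≡0⇒≡ (false ∷ u) (false ∷ v) h = cong (false ∷_) (hamming≡0⇒≡ u v h)

hamming-refl : (v : Vertex d) → hamming v v ≡ 0
hamming-refl []          = refl
hamming-refl (true ∷ v)  = hamming-refl v
hamming-refl (false ∷ v) = hamming-refl v

hamming≤dim : (u v : Vertex d) → hamming u v ≤ d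
hamming≤dim []          []          = z≤n
hamming≤dim (true ∷ u)  (true ∷ v)  = ℕ.m≤n⇒m≤1+n (hamming≤dim u v)
hamming≤dim (false ∷ u) (false ∷ v) = ℕ.m≤n⇒m≤1+n (hamming≤dim u v)
hamming≤dim (true ∷ u)  (false ∷ v) = s≤s (hamming≤dim u v)
hamming≤dim (false ∷ u) (true ∷ v)  = s≤s (hamming≤dim u v)

flip-adjacent : (b : Bool) (v : Vertex d) → Adjacent (b ∷ v) (not b ∷ v)
flip-adjacent true  v = cong suc (hamming-refl v)
flip-adjacent false v = cong suc (hamming-refl v)

parity-suc : ∀ n → ℕ.parity (suc n) ≡ ℕ.parity n ⁻¹
parity-suc n = trans (sym (⁻¹-involutive _)) (cong _⁻¹ (suc-homo-⁻¹ n))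

adjacent⇒opposite-parity : (u v : Vertex d) → Adjacent u v → vertexParity u ≡ vertexParity v ⁻¹
adjacent⇒opposite-parity []          []          ()
adjacent⇒opposite-parity (true ∷ u)  (true ∷ v)  h = begin
  ℕ.parity (suc (ones u))    ≡⟨ parity-suc (ones u) ⟩
  vertexParity u ⁻¹          ≡⟨ cong _⁻¹ (adjacent⇒opposite-parity u v h) ⟩
  vertexParity v ⁻¹ ⁻¹       ≡⟨ cong _⁻¹ (parity-suc (ones v)) ⟨
  ℕ.parity (suc (ones v)) ⁻¹ ∎
  where open ≡-Reasoning
adjacent⇒opposite-parity (false ∷ u) (false ∷ v) h = adjacent⇒opposite-parity u v h
adjacent⇒opposite-parity (true ∷ u)  (false ∷ v) h
  rewrite hamming≡0⇒≡ u v (ℕ.suc-injective h) = parity-suc (ones v)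
adjacent⇒opposite-parity (false ∷ u) (true ∷ v)  h
  rewrite hamming≡0⇒≡ u v (ℕ.suc-injective h) = sym (suc-homo-⁻¹ (ones v))

restrict : (b : Bool) (f : Vertex (suc d) → ℤ) → InA (suc d) f → InA d (λ v → f (b ∷ v))
restrict true  f hf u v = hf (true ∷ u) (true ∷ v)
restrict false f hf u v = hf (false ∷ u) (false ∷ v)

∣-∣-triangle : ∀ a b c → ∣ a ℤ.- c ∣ ≤ ∣ a ℤ.- b ∣ ℕ.+ ∣ b ℤ.- c ∣
∣-∣-triangle a b c = subst (λ z → ∣ z ∣ ≤ ∣ a ℤ.- b ∣ ℕ.+ ∣ b ℤ.- c ∣)
  (telescope a b c) (ℤ.∣i+j∣≤∣i∣+∣j∣ (a ℤ.- b) (b ℤ.- c))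
  where
  telescope : ∀ a b c → (a ℤ.- b) ℤ.+ (b ℤ.- c) ≡ a ℤ.- c
  telescope = ℤ-Solver.solve-∀

∣f-f∣≤hamming : (f : Vertex d → ℤ) → InA d f → ∀ u v → ∣ f u ℤ.- f v ∣ ≤ hamming u v
across-∣f-f∣≤hamming : (b : Bool) (f : Vertex (suc d) → ℤ) → InA (suc d) f →
                       ∀ u v → ∣ f (b ∷ u) ℤ.- f (not b ∷ v) ∣ ≤ suc (hamming u v)

∣f-f∣≤hamming f hf []          []          = ℕ.≤-reflexive (cong ∣_∣ (ℤ.+-inverseʳ (f [])))
∣f-f∣≤hamming f hf (true ∷ u)  (true ∷ v)  = ∣f-f∣≤hamming (λ w → f (true ∷ w)) (restrict true f hf) u v
∣f-f∣≤hamming f hf (false ∷ u) (false ∷ v) = ∣f-f∣≤hamming (λ w → f (false ∷ w)) (restrict false f hf) u v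
∣f-f∣≤hamming f hf (true ∷ u)  (false ∷ v) = across-∣f-f∣≤hamming true f hf u v
∣f-f∣≤hamming f hf (false ∷ u) (true ∷ v)  = across-∣f-f∣≤hamming false f hf u v

across-∣f-f∣≤hamming b f hf u v = begin
  ∣ f (b ∷ u) ℤ.- f (not b ∷ v) ∣
    ≤⟨ ∣-∣-triangle (f (b ∷ u)) (f (b ∷ v)) _ ⟩
  ∣ f (b ∷ u) ℤ.- f (b ∷ v) ∣ ℕ.+ ∣ f (b ∷ v) ℤ.- f (not b ∷ v) ∣
    ≡⟨ cong (∣ f (b ∷ u) ℤ.- f (b ∷ v) ∣ ℕ.+_) (hf _ _ (flip-adjacent b v)) ⟩
  ∣ f (b ∷ u) ℤ.- f (b ∷ v) ∣ ℕ.+ 1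
    ≤⟨ ℕ.+-monoˡ-≤ 1 (∣f-f∣≤hamming (λ w → f (b ∷ w)) (restrict b f hf) u v) ⟩
  hamming u v ℕ.+ 1
    ≡⟨ ℕ.+-comm (hamming u v) 1 ⟩
  suc (hamming u v) ∎
  where open ℕ.≤-Reasoning

-- Codings into finite types

combine-injective : (i k : Fin c) (j l : Fin d) → combine i j ≡ combine k l → i ≡ k × j ≡ l
combine-injective i k j l e = combine-injectiveˡ i j k l e , combine-injectiveʳ i j k l e

vecCode : (A → Fin c) → Vec A k → Fin (c ℕ.^ k)
vecCode code []       = Fin.zero
vecCode code (x ∷ xs) = combine (code x) (vecCode code xs)

vecCode-injective : {code : A → Fin c} → Injective _≡_ _≡_ code →
                    Injective _≡_ _≡_ (vecCode {k = k} code)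
vecCode-injective code-inj {[]}     {[]}     _ = refl
vecCode-injective code-inj {x ∷ xs} {y ∷ ys} e
  with x≡y , xs≡ys ← combine-injective _ _ _ _ e =
  cong₂ _∷_ (code-inj x≡y) (vecCode-injective code-inj xs≡ys)

vecDecode : (k : ℕ) → (Fin c → A) → Fin (c ℕ.^ k) → Vec A k
vecDecode         zero    decode _ = []
vecDecode {c = c} (suc k) decode j =
  decode (proj₁ (remQuot {c} (c ℕ.^ k) j)) ∷ vecDecode k decode (proj₂ (remQuot {c} (c ℕ.^ k) j))

vecCode-vecDecode : {code : A → Fin c} {decode : Fin c → A} → (∀ i → code (decode i) ≡ i) →
                    ∀ k (j : Fin (c ℕ.^ k)) → vecCode code (vecDecode k decode j) ≡ j
vecCode-vecDecode _ zero Fin.zero = refl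
vecCode-vecDecode {c = c} {code = code} {decode} code∘decode (suc k) j = begin
  combine (code (decode i)) (vecCode code (vecDecode k decode j′))
    ≡⟨ cong₂ combine (code∘decode i) (vecCode-vecDecode code∘decode k j′) ⟩
  combine i j′
    ≡⟨ combine-remQuot {c} (c ℕ.^ k) j ⟩
  j ∎
  where
  open ≡-Reasoning
  i = proj₁ (remQuot {c} (c ℕ.^ k) j)
  j′ = proj₂ (remQuot {c} (c ℕ.^ k) j)

lookup-extensional : {xs ys : Vec A k} → (∀ i → lookup xs i ≡ lookup ys i) → xs ≡ ys
lookup-extensional {xs = xs} {ys} same = begin
  xs                       ≡⟨ tabulate∘lookup xs ⟨
  Vec.tabulate (lookup xs) ≡⟨ tabulate-cong same ⟩
  Vec.tabulate (lookup ys) ≡⟨ tabulate∘lookup ys ⟩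
  ys                       ∎
  where open ≡-Reasoning

boolCode : Bool → Fin 2
boolCode false = Fin.zero
boolCode true  = Fin.suc Fin.zero

boolDecode : Fin 2 → Bool
boolDecode Fin.zero    = false
boolDecode (Fin.suc _) = true

boolCode-injective : Injective _≡_ _≡_ boolCode
boolCode-injective {false} {false} _ = refl
boolCode-injective {true}  {true}  _ = refl

boolCode-boolDecode : ∀ i → boolCode (boolDecode i) ≡ i
boolCode-boolDecode Fin.zero           = refl
boolCode-boolDecode (Fin.suc Fin.zero) = refl

vertexCode : Vertex d → Fin (2 ℕ.^ d)
vertexCode = vecCode boolCode

vertexDecode : (d : ℕ) → Fin (2 ℕ.^ d) → Vertex d
vertexDecode d = vecDecode d boolDecode

vertexCode-injective : Injective _≡_ _≡_ (vertexCode {d})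
vertexCode-injective = vecCode-injective boolCode-injective

vertexCode-vertexDecode : ∀ d (j : Fin (2 ℕ.^ d)) → vertexCode (vertexDecode d j) ≡ j
vertexCode-vertexDecode = vecCode-vecDecode boolCode-boolDecode

vertexDecode-injective : ∀ d → Injective _≡_ _≡_ (vertexDecode d)
vertexDecode-injective d {i} {j} e = begin
  i                             ≡⟨ vertexCode-vertexDecode d i ⟨
  vertexCode (vertexDecode d i) ≡⟨ cong vertexCode e ⟩
  vertexCode (vertexDecode d j) ≡⟨ vertexCode-vertexDecode d j ⟩
  j                             ∎
  where open ≡-Reasoning

signCode : Sign → Fin 2
signCode Sign.- = Fin.zero
signCode Sign.+ = Fin.suc Fin.zero

signDecode : Fin 2 → Sign
signDecode Fin.zero    = Sign.-
signDecode (Fin.suc _) = Sign.+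

signDecode-signCode : ∀ s → signDecode (signCode s) ≡ s
signDecode-signCode Sign.- = refl
signDecode-signCode Sign.+ = refl

ValueCode : ℕ → Set
ValueCode d = Fin (2 ℕ.* suc d)

-- Injective only on integers of absolute value at most d; larger absolute values are taken mod d + 1.
valueCode : (d : ℕ) → ℤ → ValueCode d
valueCode d z = combine (signCode (sign z)) (∣ z ∣ mod suc d)

valueDecode : (d : ℕ) → ValueCode d → ℤ
valueDecode d = fromSignAbs ∘ remQuot (suc d)
  where
  fromSignAbs : Fin 2 × Fin (suc d) → ℤ
  fromSignAbs (s , n) = signDecode s ◃ toℕ n

valueDecode-valueCode : ∀ {z} → ∣ z ∣ ≤ d → valueDecode d (valueCode d z) ≡ z
valueDecode-valueCode {d} {z} ∣z∣≤d = begin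
  valueDecode d (valueCode d z)
    ≡⟨ cong (λ p → signDecode (proj₁ p) ◃ toℕ (proj₂ p)) (remQuot-combine (signCode (sign z)) (∣ z ∣ mod suc d)) ⟩
  signDecode (signCode (sign z)) ◃ toℕ (∣ z ∣ mod suc d)
    ≡⟨ cong₂ _◃_ (signDecode-signCode (sign z)) ∣z∣-digit ⟩
  sign z ◃ ∣ z ∣
    ≡⟨ ℤ.◃-inverse z ⟩
  z ∎
  where
  open ≡-Reasoning
  ∣z∣-digit : toℕ (∣ z ∣ mod suc d) ≡ ∣ z ∣
  ∣z∣-digit = trans (Fin.toℕ-fromℕ< _) (m<n⇒m%n≡m (s≤s ∣z∣≤d))

valueCode-injective : ∀ {x y} → ∣ x ∣ ≤ d → ∣ y ∣ ≤ d → valueCode d x ≡ valueCode d y → x ≡ y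
valueCode-injective {d} {x} {y} ∣x∣≤d ∣y∣≤d e = begin
  x                             ≡⟨ valueDecode-valueCode ∣x∣≤d ⟨
  valueDecode d (valueCode d x) ≡⟨ cong (valueDecode d) e ⟩
  valueDecode d (valueCode d y) ≡⟨ valueDecode-valueCode ∣y∣≤d ⟩
  y                             ∎
  where open ≡-Reasoning

private variable
  f g h : Vertex d → ℤ

SameClass-sym : SameClass f g → SameClass g f
SameClass-sym {f = f} {g} (c , f≡g+c) = ℤ.- c , λ v → begin
  g v                   ≡⟨ shift (g v) c ⟩
  (g v ℤ.+ c) ℤ.+ ℤ.- c ≡⟨ cong (ℤ._+ ℤ.- c) (f≡g+c v) ⟨
  f v ℤ.+ ℤ.- c         ∎
  where
  open ≡-Reasoning
  shift : ∀ x c → x ≡ (x ℤ.+ c) ℤ.+ ℤ.- c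
  shift = ℤ-Solver.solve-∀

SameClass-trans : SameClass f g → SameClass g h → SameClass f h
SameClass-trans {f = f} {g} {h} (c , f≡g+c) (c′ , g≡h+c′) = c′ ℤ.+ c , λ v → begin
  f v                ≡⟨ f≡g+c v ⟩
  g v ℤ.+ c          ≡⟨ cong (ℤ._+ c) (g≡h+c′ v) ⟩
  (h v ℤ.+ c′) ℤ.+ c ≡⟨ ℤ.+-assoc (h v) c′ c ⟩
  h v ℤ.+ (c′ ℤ.+ c) ∎
  where open ≡-Reasoning

module _ {P : (Vertex d → ℤ) → Set} {n : ℕ} (classes : NumClasses d P n) where
  open NumClasses classes

  numClasses≤ : ∀ {N} (code : ∀ f → P f → Fin N) →
                (∀ f g pf pg → code f pf ≡ code g pg → SameClass f g) → n ≤ N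
  numClasses≤ code sound = Fin.injective⇒≤ λ {i} {j} e →
    inj i j (sound (rep i) (rep j) (repP i) (repP j) e)

  ≤numClasses : ∀ {k} (F : Fin k → Vertex d → ℤ) → (∀ i → P (F i)) →
                (∀ i j → SameClass (F i) (F j) → i ≡ j) → k ≤ n
  ≤numClasses F PF distinct = Fin.injective⇒≤ {f = class} λ {i} {j} e →
    distinct i j (SameClass-trans {f = F i} {rep (class i)} {F j} (represented i)
                   (SameClass-sym {f = F j} (subst (SameClass (F j) ∘ rep) (sym e) (represented j))))
    where
    class : Fin _ → Fin n
    class i = proj₁ (surj (F i) (PF i))
    represented : ∀ i → SameClass (F i) (rep (class i))
    represented i = proj₂ (surj (F i) (PF i))

-- Lower bound on the number of classes

±1 : Bool → ℤ
±1 false = ℤ.-1ℤ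
±1 true  = + 1

±1-injective : Injective _≡_ _≡_ ±1
±1-injective {false} {false} _ = refl
±1-injective {true}  {true}  _ = refl

height : Parity → Bool → ℤ
height 0ℙ _ = + 0
height 1ℙ b = ±1 b

∣height⁻¹-height∣≡1 : ∀ p a b → ∣ height (p ⁻¹) a ℤ.- height p b ∣ ≡ 1
∣height⁻¹-height∣≡1 0ℙ false b     = refl
∣height⁻¹-height∣≡1 0ℙ true  b     = refl
∣height⁻¹-height∣≡1 1ℙ a     false = refl
∣height⁻¹-height∣≡1 1ℙ a     true  = refl

-- The truth table t gives the sign at the odd vertex lying over each v ∈ Q_d.
signsOnOdd : Vertex (2 ℕ.^ d) → Vertex (suc d) → ℤ
signsOnOdd t (x ∷ v) = height (vertexParity (x ∷ v)) (lookup t (vertexCode v))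

signsOnOdd∈A : (t : Vertex (2 ℕ.^ d)) → InA (suc d) (signsOnOdd t)
signsOnOdd∈A t u@(_ ∷ _) v@(_ ∷ _) u~v
  rewrite adjacent⇒opposite-parity u v u~v = ∣height⁻¹-height∣≡1 (vertexParity v) _ _

odd-extension : (v : Vertex d) → ∃ λ x → vertexParity (x ∷ v) ≡ 1ℙ
odd-extension v with vertexParity v in p
... | 0ℙ = true  , trans (parity-suc (ones v)) (cong _⁻¹ p)
... | 1ℙ = false , p

height-even : ∀ {p} → p ≡ 0ℙ → ∀ b → height p b ≡ + 0
height-even refl _ = refl

height-odd : ∀ {p} → p ≡ 1ℙ → ∀ b → height p b ≡ ±1 b
height-odd refl _ = refl

signsOnOdd-injective : (s t : Vertex (2 ℕ.^ d)) → SameClass (signsOnOdd s) (signsOnOdd t) → s ≡ t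
signsOnOdd-injective {d} s t (c , s≡t+c) = lookup-extensional λ j →
  subst (λ i → lookup s i ≡ lookup t i) (vertexCode-vertexDecode d j) (same-lookup (vertexDecode d j))
  where
  open ≡-Reasoning
  c≡0 : c ≡ + 0
  c≡0 = sym (begin
    + 0                                 ≡⟨ height-even (origin-even {suc d}) _ ⟨
    signsOnOdd s (origin {suc d})       ≡⟨ s≡t+c origin ⟩
    signsOnOdd t (origin {suc d}) ℤ.+ c ≡⟨ cong (ℤ._+ c) (height-even (origin-even {suc d}) _) ⟩
    + 0 ℤ.+ c                           ≡⟨ ℤ.+-identityˡ c ⟩
    c                                   ∎)
  same-lookup : ∀ v → lookup s (vertexCode v) ≡ lookup t (vertexCode v)
  same-lookup v with x , odd ← odd-extension v = ±1-injective (begin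
    ±1 (lookup s (vertexCode v))         ≡⟨ height-odd odd _ ⟨
    signsOnOdd s (x ∷ v)                 ≡⟨ s≡t+c (x ∷ v) ⟩
    signsOnOdd t (x ∷ v) ℤ.+ c           ≡⟨ cong₂ ℤ._+_ (height-odd odd _) c≡0 ⟩
    ±1 (lookup t (vertexCode v)) ℤ.+ + 0 ≡⟨ ℤ.+-identityʳ _ ⟩
    ±1 (lookup t (vertexCode v))         ∎)

2^2^d≤numClasses : ∀ {m} → NumClasses (suc d) (InB (suc d)) m → 2 ℕ.^ (2 ℕ.^ d) ≤ m
2^2^d≤numClasses {d} classes = ≤numClasses classes
  (signsOnOdd ∘ vertexDecode (2 ℕ.^ d)) (signsOnOdd∈A ∘ vertexDecode (2 ℕ.^ d))
  λ i j same → vertexDecode-injective (2 ℕ.^ d) (signsOnOdd-injective _ _ same)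

-- Upper bound on the number of mostly constant classes

module _ {K V : Set} (_≟_ : DecidableEquality K) where

  lookupOr : Vec (K × V) c → K → V → V
  lookupOr []              k a = a
  lookupOr ((k′ , b) ∷ es) k a with k ≟ k′
  ... | yes _ = b
  ... | no  _ = lookupOr es k a

  lookupOr-graph : (h : K → V) (ks : Vec K c) {k : K} {a : V} → k ∈ ks ⊎ h k ≡ a →
                   lookupOr (Vec.map (λ k → k , h k) ks) k a ≡ h k
  lookupOr-graph h []        (inj₂ hk≡a) = sym hk≡a
  lookupOr-graph h (k′ ∷ ks) {k} k∈ks⊎hk≡a with k ≟ k′
  ... | yes k≡k′ = cong h (sym k≡k′)
  ... | no  k≢k′ with k∈ks⊎hk≡a
  ...   | inj₁ (VecAny.here k≡k′) = ⊥-elim (k≢k′ k≡k′)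
  ...   | inj₁ (VecAny.there k∈ks) = lookupOr-graph h ks (inj₁ k∈ks)
  ...   | inj₂ hk≡a                = lookupOr-graph h ks (inj₂ hk≡a)

∈-padRight⁺ : ∀ {m n x a} {xs : Vec A m} (m≤n : m ≤ n) → x ∈ xs → x ∈ padRight m≤n a xs
∈-padRight⁺ (s≤s m≤n) (VecAny.here x≡y)  = VecAny.here x≡y
∈-padRight⁺ (s≤s m≤n) (VecAny.there x∈xs) = VecAny.there (∈-padRight⁺ m≤n x∈xs)

∈-allVertices : (v : Vertex d) → v List.∈ allVertices d
∈-allVertices []          = here refl
∈-allVertices (false ∷ v) = ∈-++⁺ˡ (∈-map⁺ (false ∷_) (∈-allVertices v))
∈-allVertices (true ∷ v)  = ∈-++⁺ʳ (List.map (false ∷_) (allVertices _)) (∈-map⁺ (true ∷_) (∈-allVertices v))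

choose : Parity → A → A → A
choose 0ℙ a b = a
choose 1ℙ a b = b

choose-map : {B : Set} (F : A → B) (p : Parity) (a b : A) → F (choose p a b) ≡ choose p (F a) (F b)
choose-map F 0ℙ a b = refl
choose-map F 1ℙ a b = refl

exceptionalE? : (f : Vertex d → ℤ) (c : ℤ) (v : Vertex d) → Dec (InE v × ¬ f v ≡ c)
exceptionalE? f c v = InE? v ×-dec ¬? (f v ℤ.≟ c)

exceptionalO? : (f : Vertex d → ℤ) (c : ℤ) (v : Vertex d) → Dec (InO v × ¬ f v ≡ c)
exceptionalO? f c v = InO? v ×-dec ¬? (f v ℤ.≟ c)

exceptions : (d : ℕ) → (Vertex d → ℤ) → ℤ → ℤ → List (Vertex d)
exceptions d f cE cO = filter (exceptionalE? f cE) (allVertices d) ++ filter (exceptionalO? f cO) (allVertices d)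

length-exceptions : ∀ d f cE cO → length (exceptions d f cE cO) ≡ exceptE d f cE ℕ.+ exceptO d f cO
length-exceptions d f cE cO = length-++ (filter (exceptionalE? f cE) (allVertices d))

exception-or-constant : ∀ (f : Vertex d → ℤ) cE cO v →
                        v List.∈ exceptions d f cE cO ⊎ f v ≡ choose (vertexParity v) cE cO
exception-or-constant {d} f cE cO v with vertexParity v in p
... | 0ℙ with f v ℤ.≟ cE
...   | yes fv≡cE = inj₂ fv≡cE
...   | no  fv≢cE = inj₁ (∈-++⁺ˡ (∈-filter⁺ (exceptionalE? f cE) (∈-allVertices v) (even⇒InE v p , fv≢cE)))
exception-or-constant {d} f cE cO v | 1ℙ with f v ℤ.≟ cO
...   | yes fv≡cO = inj₂ fv≡cO
...   | no  fv≢cO = inj₁ (∈-++⁺ʳ (filter (exceptionalE? f cE) (allVertices d))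
                           (∈-filter⁺ (exceptionalO? f cO) (∈-allVertices v) (odd⇒InO v p , fv≢cO)))

-- Codes f - f(0) for a mostly constant f: the two constant values, then (vertex, value) pairs
-- covering all exceptional vertices, padded to length L.
Descriptor : ℕ → ℕ → Set
Descriptor d L = ValueCode d × ValueCode d × Vec (Vertex d × ValueCode d) L

_≟ᵛ_ : DecidableEquality (Vertex d)
_≟ᵛ_ = ≡-dec Bool._≟_

normalise : (Vertex d → ℤ) → Vertex d → ℤ
normalise f v = f v ℤ.- f origin

valueAt : ∀ {L} → Descriptor d L → Vertex d → ValueCode d
valueAt (e , o , es) v = lookupOr _≟ᵛ_ es v (choose (vertexParity v) e o)

descriptor : ∀ {L} (f : Vertex d → ℤ) cE cO → length (exceptions d f cE cO) ≤ L → Descriptor d L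
descriptor {d} f cE cO fits =
  valueCode d (cE ℤ.- f origin) , valueCode d (cO ℤ.- f origin) ,
  Vec.map (λ w → w , valueCode d (normalise f w)) (padRight fits origin (fromList (exceptions d f cE cO)))

valueAt-descriptor : ∀ {L} (f : Vertex d → ℤ) cE cO (fits : length (exceptions d f cE cO) ≤ L) v →
                     valueAt (descriptor f cE cO fits) v ≡ valueCode d (normalise f v)
valueAt-descriptor {d} f cE cO fits v =
  lookupOr-graph _≟ᵛ_ (valueCode d ∘ normalise f) (padRight fits origin (fromList (exceptions d f cE cO)))
    (Sum.map (∈-padRight⁺ fits ∘ ∈-fromList⁺) default-value (exception-or-constant f cE cO v))
  where
  default-value : f v ≡ choose (vertexParity v) cE cO →
                  valueCode d (normalise f v) ≡ choose (vertexParity v) (valueCode d (cE ℤ.- f origin)) (valueCode d (cO ℤ.- f origin))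
  default-value fv≡c = trans (cong (λ c → valueCode d (c ℤ.- f origin)) fv≡c)
                             (choose-map (λ c → valueCode d (c ℤ.- f origin)) (vertexParity v) cE cO)

∣normalise∣≤dim : (f : Vertex d → ℤ) → InA d f → ∀ v → ∣ normalise f v ∣ ≤ d
∣normalise∣≤dim f hf v = ℕ.≤-trans (∣f-f∣≤hamming f hf v origin) (hamming≤dim v origin)

descriptor-sameClass : ∀ {L} (f f′ : Vertex d → ℤ) → InA d f → InA d f′ → ∀ {cE cO cE′ cO′}
                       (fits : length (exceptions d f cE cO) ≤ L) (fits′ : length (exceptions d f′ cE′ cO′) ≤ L) →
                       descriptor f cE cO fits ≡ descriptor f′ cE′ cO′ fits′ → SameClass f f′
descriptor-sameClass {d} f f′ hf hf′ {cE} {cO} {cE′} {cO′} fits fits′ same =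
  f origin ℤ.- f′ origin , λ v → unshift (f v) (f′ v) (f origin) (f′ origin) (same-normalisation v)
  where
  same-normalisation : ∀ v → normalise f v ≡ normalise f′ v
  same-normalisation v = valueCode-injective (∣normalise∣≤dim f hf v) (∣normalise∣≤dim f′ hf′ v) (begin
    valueCode d (normalise f v)             ≡⟨ valueAt-descriptor f cE cO fits v ⟨
    valueAt (descriptor f cE cO fits) v     ≡⟨ cong (λ D → valueAt D v) same ⟩
    valueAt (descriptor f′ cE′ cO′ fits′) v ≡⟨ valueAt-descriptor f′ cE′ cO′ fits′ v ⟩
    valueCode d (normalise f′ v)            ∎)
    where open ≡-Reasoning
  unshift : ∀ a b x y → a ℤ.- x ≡ b ℤ.- y → a ≡ b ℤ.+ (x ℤ.- y)
  unshift a b x y e = begin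
    a               ≡⟨ cancel a x ⟨
    (a ℤ.- x) ℤ.+ x ≡⟨ cong (ℤ._+ x) e ⟩
    (b ℤ.- y) ℤ.+ x ≡⟨ regroup b x y ⟩
    b ℤ.+ (x ℤ.- y) ∎
    where
    open ≡-Reasoning
    cancel : ∀ a x → (a ℤ.- x) ℤ.+ x ≡ a
    cancel = ℤ-Solver.solve-∀
    regroup : ∀ b x y → (b ℤ.- y) ℤ.+ x ≡ b ℤ.+ (x ℤ.- y)
    regroup = ℤ-Solver.solve-∀

#Descriptors : ℕ → ℕ → ℕ
#Descriptors d L = 2 ℕ.* suc d ℕ.* (2 ℕ.* suc d ℕ.* (2 ℕ.^ d ℕ.* (2 ℕ.* suc d)) ℕ.^ L)

entryCode : Vertex d × ValueCode d → Fin (2 ℕ.^ d ℕ.* (2 ℕ.* suc d))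
entryCode (w , x) = combine (vertexCode w) x

entryCode-injective : Injective _≡_ _≡_ (entryCode {d})
entryCode-injective {x = w , x} {y = w′ , x′} e with w≡w′ , x≡x′ ← combine-injective _ _ _ _ e =
  cong₂ _,_ (vertexCode-injective w≡w′) x≡x′

descriptorCode : ∀ {L} → Descriptor d L → Fin (#Descriptors d L)
descriptorCode (e , o , es) = combine e (combine o (vecCode entryCode es))

descriptorCode-injective : ∀ {L} → Injective _≡_ _≡_ (descriptorCode {d} {L})
descriptorCode-injective {x = e , o , es} {y = e′ , o′ , es′} same
  with e≡e′ , rest ← combine-injective _ _ _ _ same
  with o≡o′ , es≡es′ ← combine-injective _ _ _ _ rest =
  cong₂ _,_ e≡e′ (cong₂ _,_ o≡o′ (vecCode-injective entryCode-injective es≡es′))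

record MostlyConstantWithin (d L : ℕ) (f : Vertex d → ℤ) : Set where
  field
    ∈A    : InA d f
    cE cO : ℤ
    few   : exceptE d f cE ℕ.+ exceptO d f cO ≤ L

  fits : length (exceptions d f cE cO) ≤ L
  fits = subst (_≤ L) (sym (length-exceptions d f cE cO)) few

numClasses≤#Descriptors : ∀ {P : (Vertex d → ℤ) → Set} {n} L → NumClasses d P n →
                          (∀ f → P f → MostlyConstantWithin d L f) → n ≤ #Descriptors d L
numClasses≤#Descriptors {d} {P} L classes mostly = numClasses≤ classes code sound
  where
  open MostlyConstantWithin
  code : ∀ f → P f → Fin (#Descriptors d L)
  code f pf = descriptorCode (descriptor f _ _ (fits (mostly f pf)))
  sound : ∀ f g pf pg → code f pf ≡ code g pg → SameClass f g
  sound f g pf pg same = descriptor-sameClass f g (∈A (mostly f pf)) (∈A (mostly g pg))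
                           (fits (mostly f pf)) (fits (mostly g pg)) (descriptorCode-injective same)

-- Arithmetic estimates

module Arithmetic where
  open import Data.Nat
  open import Data.Nat.Properties
  open import Data.Nat.Tactic.RingSolver using (solve-∀)
  open ≤-Reasoning

  bernoulli : ∀ t n → t ^ n * (t + n) ≤ t * suc t ^ n
  bernoulli t zero    = ≤-reflexive (eq t)
    where
    eq : ∀ t → 1 * (t + 0) ≡ t * 1
    eq = solve-∀
  bernoulli t (suc n) = begin
    t * t ^ n * (t + suc n)   ≡⟨ eq₁ t (t ^ n) (t + suc n) ⟩
    t ^ n * (t * (t + suc n)) ≤⟨ *-monoʳ-≤ (t ^ n) step ⟩
    t ^ n * (suc t * (t + n)) ≡⟨ eq₂ (t ^ n) (suc t) (t + n) ⟩
    suc t * (t ^ n * (t + n)) ≤⟨ *-monoʳ-≤ (suc t) (bernoulli t n) ⟩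
    suc t * (t * suc t ^ n)   ≡⟨ eq₂ (suc t) t (suc t ^ n) ⟩
    t * (suc t * suc t ^ n)   ∎
    where
    eq₁ : ∀ t x m → t * x * m ≡ x * (t * m)
    eq₁ = solve-∀
    eq₂ : ∀ x y z → x * (y * z) ≡ y * (x * z)
    eq₂ = solve-∀
    step : t * (t + suc n) ≤ suc t * (t + n)
    step = subst₂ _≤_ (eq₃ t n) (eq₄ t n) (+-monoʳ-≤ (t * t + t * n + t) (z≤n {n}))
      where
      eq₃ : ∀ t n → t * t + t * n + t + 0 ≡ t * (t + suc n)
      eq₃ = solve-∀
      eq₄ : ∀ t n → t * t + t * n + t + n ≡ suc t * (t + n)
      eq₄ = solve-∀

  2*t^t≤[1+t]^t : ∀ t → 1 ≤ t → 2 * t ^ t ≤ suc t ^ t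
  2*t^t≤[1+t]^t t@(suc _) _ = *-cancelˡ-≤ t (begin
    t * (2 * t ^ t) ≡⟨ eq t (t ^ t) ⟩
    t ^ t * (t + t) ≤⟨ bernoulli t t ⟩
    t * suc t ^ t   ∎)
    where
    eq : ∀ t x → t * (2 * x) ≡ x * (t + t)
    eq = solve-∀

  n*n≤2^n : ∀ n → 4 ≤ n → n * n ≤ 2 ^ n
  n*n≤2^n n 4≤n = go (n ∸ 4) (m∸n+n≡m 4≤n)
    where
    go : ∀ i {n} → i + 4 ≡ n → n * n ≤ 2 ^ n
    go zero    refl = ≤-refl
    go (suc i) refl = begin
      suc (i + 4) * suc (i + 4) ≤⟨ step i ⟩
      2 * ((i + 4) * (i + 4))   ≤⟨ *-monoʳ-≤ 2 (go i refl) ⟩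
      2 * 2 ^ (i + 4)           ∎
      where
      step : ∀ i → suc (i + 4) * suc (i + 4) ≤ 2 * ((i + 4) * (i + 4))
      step i = subst₂ _≤_ (eq₁ i) (eq₂ i) (m≤m+n (i * i + 10 * i + 25) (i * i + 6 * i + 7))
        where
        eq₁ : ∀ i → i * i + 10 * i + 25 ≡ suc (i + 4) * suc (i + 4)
        eq₁ = solve-∀
        eq₂ : ∀ i → i * i + 10 * i + 25 + (i * i + 6 * i + 7) ≡ 2 * ((i + 4) * (i + 4))
        eq₂ = solve-∀

  ^-distribʳ-* : ∀ m n o → (m * n) ^ o ≡ m ^ o * n ^ o
  ^-distribʳ-* m n zero    = refl
  ^-distribʳ-* m n (suc o) = trans (cong (m * n *_) (^-distribʳ-* m n o)) (eq m n (m ^ o) (n ^ o))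
    where
    eq : ∀ m n x y → m * n * (x * y) ≡ m * x * (n * y)
    eq = solve-∀

  -- The ratio of consecutive terms of K n t^n / (1+t)^n is t (n+1) / ((t+1) n), which is ≤ 1 once n ≥ t.
  K*n*t^n≤[1+t]^n-step : ∀ K t n → t ≤ n → K * n * t ^ n ≤ suc t ^ n →
                         K * suc n * t ^ suc n ≤ suc t ^ suc n
  K*n*t^n≤[1+t]^n-step K t n t≤n hyp = begin
    K * suc n * (t * t ^ n)   ≡⟨ eq₁ K (suc n) t (t ^ n) ⟩
    (K * t ^ n) * (t * suc n) ≤⟨ *-monoʳ-≤ (K * t ^ n) ratio ⟩
    (K * t ^ n) * (suc t * n) ≡⟨ eq₂ K (t ^ n) (suc t) n ⟩
    suc t * (K * n * t ^ n)   ≤⟨ *-monoʳ-≤ (suc t) hyp ⟩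
    suc t * suc t ^ n         ∎
    where
    eq₁ : ∀ K e t x → K * e * (t * x) ≡ (K * x) * (t * e)
    eq₁ = solve-∀
    eq₂ : ∀ K x s n → (K * x) * (s * n) ≡ s * (K * n * x)
    eq₂ = solve-∀
    ratio : t * suc n ≤ suc t * n
    ratio = subst₂ _≤_ (eq₃ t n) (eq₄ t n) (+-monoˡ-≤ (t * n) t≤n)
      where
      eq₃ : ∀ t n → t + t * n ≡ t * suc n
      eq₃ = solve-∀
      eq₄ : ∀ t n → n + t * n ≡ suc t * n
      eq₄ = solve-∀

  -- Base case at n₀ = t j with j = 4 + K t: there (1+t)^n₀ ≥ 2^j t^n₀ ≥ j² t^n₀ ≥ K n₀ t^n₀.
  K*n*t^n≤[1+t]^n-eventually : ∀ K t → 1 ≤ t → ∃ λ n₀ → ∀ n → n₀ ≤ n → K * n * t ^ n ≤ suc t ^ n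
  K*n*t^n≤[1+t]^n-eventually K t 1≤t = t * j , λ n n₀≤n → from-base (n ∸ t * j) (m∸n+n≡m n₀≤n)
    where
    j = 4 + K * t
    base : K * (t * j) * t ^ (t * j) ≤ suc t ^ (t * j)
    base = begin
      K * (t * j) * t ^ (t * j)  ≡⟨ cong (K * (t * j) *_) (^-*-assoc t t j) ⟨
      K * (t * j) * (t ^ t) ^ j  ≤⟨ *-monoˡ-≤ ((t ^ t) ^ j) K*t*j≤2^j ⟩
      2 ^ j * (t ^ t) ^ j        ≡⟨ ^-distribʳ-* 2 (t ^ t) j ⟨
      (2 * t ^ t) ^ j            ≤⟨ ^-monoˡ-≤ j (2*t^t≤[1+t]^t t 1≤t) ⟩
      (suc t ^ t) ^ j            ≡⟨ ^-*-assoc (suc t) t j ⟩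
      suc t ^ (t * j)            ∎
      where
      K*t*j≤2^j : K * (t * j) ≤ 2 ^ j
      K*t*j≤2^j = begin
        K * (t * j) ≡⟨ *-assoc K t j ⟨
        K * t * j   ≤⟨ *-monoˡ-≤ j (m≤n+m (K * t) 4) ⟩
        j * j       ≤⟨ n*n≤2^n j (m≤m+n 4 (K * t)) ⟩
        2 ^ j       ∎
    t≤t*j : t ≤ t * j
    t≤t*j = m≤m*n t j
    from-base : ∀ i {n} → i + t * j ≡ n → K * n * t ^ n ≤ suc t ^ n
    from-base zero    refl = base
    from-base (suc i) refl = K*n*t^n≤[1+t]^n-step K t (i + t * j)
      (≤-trans t≤t*j (m≤n+m (t * j) i)) (from-base i refl)

  suc[n]≤2^n : ∀ n → suc n ≤ 2 ^ n
  suc[n]≤2^n zero    = ≤-refl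
  suc[n]≤2^n (suc n) = begin
    1 + suc n         ≤⟨ +-mono-≤ (m^n>0 2 n) (suc[n]≤2^n n) ⟩
    2 ^ n + 2 ^ n     ≡⟨ cong (_+_ (2 ^ n)) (+-identityʳ (2 ^ n)) ⟨
    2 ^ suc n         ∎

  descriptorBits : ℕ → ℕ → ℕ
  descriptorBits d L = suc d + (suc d + (d + suc d) * L)

  #Descriptors≤2^descriptorBits : ∀ d L → #Descriptors d L ≤ 2 ^ descriptorBits d L
  #Descriptors≤2^descriptorBits d L = begin
    2 * suc d * (2 * suc d * (2 ^ d * (2 * suc d)) ^ L)
      ≤⟨ *-mono-≤ K≤ (*-mono-≤ K≤ (^-monoˡ-≤ L (*-monoʳ-≤ (2 ^ d) K≤))) ⟩
    2 ^ suc d * (2 ^ suc d * (2 ^ d * 2 ^ suc d) ^ L)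
      ≡⟨ cong (λ x → 2 ^ suc d * (2 ^ suc d * x ^ L)) (^-distribˡ-+-* 2 d (suc d)) ⟨
    2 ^ suc d * (2 ^ suc d * (2 ^ (d + suc d)) ^ L)
      ≡⟨ cong (λ x → 2 ^ suc d * (2 ^ suc d * x)) (^-*-assoc 2 (d + suc d) L) ⟩
    2 ^ suc d * (2 ^ suc d * 2 ^ ((d + suc d) * L))
      ≡⟨ cong (2 ^ suc d *_) (^-distribˡ-+-* 2 (suc d) _) ⟨
    2 ^ suc d * 2 ^ (suc d + (d + suc d) * L)
      ≡⟨ ^-distribˡ-+-* 2 (suc d) _ ⟨
    2 ^ descriptorBits d L ∎
    where
    K≤ : 2 * suc d ≤ 2 ^ suc d
    K≤ = *-monoʳ-≤ 2 (suc[n]≤2^n d)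

  -- For α = a/b < 2 put t = 2b - 1 ≥ a: the exceptions number L ≤ 2 (a/b)^d ≤ 2 (t/b)^d,
  -- which is o(2^d / d) because t^d d = o((t+1)^d) = o((2b)^d).
  descriptorBits≤2^d′ : ∀ d′ {a k L} → let d = suc d′; b = suc k; t = suc (2 * k) in
    a < 2 * b → L * b ^ d ≤ 2 * a ^ d → 22 * d * t ^ d ≤ suc t ^ d →
    descriptorBits d L + d ≤ 2 ^ d′
  descriptorBits≤2^d′ d′ {a} {k} {L} a<2b L≤ growth =
    *-cancelʳ-≤ _ _ B {{m^n≢0 b n}} (*-cancelˡ-≤ 2 (begin
      2 * ((descriptorBits n L + n) * B)                         ≡⟨ cong (2 *_) (expand d′ L B) ⟩
      2 * ((3 * n + 2) * B + (2 * n + 1) * (L * B))              ≤⟨ *-monoʳ-≤ 2 (+-mono-≤ (*-monoʳ-≤ (3 * n + 2) B≤T)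
                                                                      (*-monoʳ-≤ (2 * n + 1) (≤-trans L≤ (*-monoʳ-≤ 2 A≤T)))) ⟩
      2 * ((3 * n + 2) * T + (2 * n + 1) * (2 * T))              ≤⟨ m≤m+n _ (8 * d′ * T) ⟩
      2 * ((3 * n + 2) * T + (2 * n + 1) * (2 * T)) + 8 * d′ * T ≡⟨ collect d′ T ⟩
      22 * n * T                                                 ≤⟨ growth ⟩
      suc t ^ n                                                  ≡⟨ cong (_^ n) 2b≡1+t ⟨
      (2 * b) ^ n                                                ≡⟨ ^-distribʳ-* 2 b n ⟩
      2 * 2 ^ d′ * B                                             ≡⟨ *-assoc 2 (2 ^ d′) B ⟩
      2 * (2 ^ d′ * B)                                           ∎))
    where
    n = suc d′
    b = suc k
    t = suc (2 * k)
    B = b ^ n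
    T = t ^ n
    2b≡1+t : 2 * b ≡ suc t
    2b≡1+t = *-suc 2 k
    B≤T : B ≤ T
    B≤T = ^-monoˡ-≤ n (s≤s (m≤m+n k _))
    A≤T : a ^ n ≤ T
    A≤T = ^-monoˡ-≤ n (≤-pred (subst (a <_) 2b≡1+t a<2b))
    expand : ∀ d′ L B → (suc (suc d′) + (suc (suc d′) + (suc d′ + suc (suc d′)) * L) + suc d′) * B ≡ (3 * suc d′ + 2) * B + (2 * suc d′ + 1) * (L * B)
    expand = solve-∀
    collect : ∀ d′ T → 2 * ((3 * suc d′ + 2) * T + (2 * suc d′ + 1) * (2 * T)) + 8 * d′ * T ≡ 22 * suc d′ * T
    collect = solve-∀

module RationalBounds where
  open import Data.Nat using (_*_; _^_)
  open ≡-Reasoning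

  _^ᵘ_ : ℚᵘ → ℕ → ℚᵘ
  p ^ᵘ zero  = ℚᵘ.1ℚᵘ
  p ^ᵘ suc n = p ℚᵘ.* (p ^ᵘ n)

  toℚᵘ-homo-^ : ∀ q n → toℚᵘ (q ^ℚ n) ℚᵘ.≃ toℚᵘ q ^ᵘ n
  toℚᵘ-homo-^ q zero    = ℚᵘ.≃-refl
  toℚᵘ-homo-^ q (suc n) = ℚᵘ.≃-trans (ℚ.toℚᵘ-homo-* q (q ^ℚ n)) (ℚᵘ.*-congˡ {toℚᵘ q} (toℚᵘ-homo-^ q n))

  ↥-* : ∀ p q → ↥ (p ℚᵘ.* q) ≡ ↥ p ℤ.* ↥ q
  ↥-* (mkℚᵘ _ _) (mkℚᵘ _ _) = refl

  ↧ₙ-* : ∀ p q → ↧ₙ (p ℚᵘ.* q) ≡ ↧ₙ p * ↧ₙ q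
  ↧ₙ-* (mkℚᵘ _ _) (mkℚᵘ _ _) = refl

  ↥-^ᵘ : ∀ a k n → ↥ (mkℚᵘ (+ a) k ^ᵘ n) ≡ + (a ^ n)
  ↥-^ᵘ a k zero    = refl
  ↥-^ᵘ a k (suc n) = begin
    ↥ (mkℚᵘ (+ a) k ℚᵘ.* (mkℚᵘ (+ a) k ^ᵘ n)) ≡⟨ ↥-* (mkℚᵘ (+ a) k) (mkℚᵘ (+ a) k ^ᵘ n) ⟩
    + a ℤ.* ↥ (mkℚᵘ (+ a) k ^ᵘ n)            ≡⟨ cong (+ a ℤ.*_) (↥-^ᵘ a k n) ⟩
    + a ℤ.* + (a ^ n)                        ≡⟨ ℤ.pos-* a (a ^ n) ⟨
    + (a * a ^ n)                            ∎

  ↧ₙ-^ᵘ : ∀ a k n → ↧ₙ (mkℚᵘ a k ^ᵘ n) ≡ suc k ^ n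
  ↧ₙ-^ᵘ a k zero    = refl
  ↧ₙ-^ᵘ a k (suc n) = trans (↧ₙ-* (mkℚᵘ a k) (mkℚᵘ a k ^ᵘ n)) (cong (suc k *_) (↧ₙ-^ᵘ a k n))

  toℚᵘ-fromℕ : ∀ n → toℚᵘ (+ n / 1) ≡ mkℚᵘ (+ n) 0
  toℚᵘ-fromℕ n = cong toℚᵘ (ℚ.↥p/↧p≡p (mkℚ (+ n) 0 (coprime-sym (1-coprimeTo n))))

  fromℕ<^⇒ : ∀ {α a k e} n → toℚᵘ α ≡ mkℚᵘ (+ a) k → (+ e / 1) ℚ.< α ^ℚ n → e * suc k ^ n < a ^ n
  fromℕ<^⇒ {α} {a} {k} {e} n α≡a/b e<αⁿ =
    ℤ.drop‿+<+ (subst₂ ℤ._<_ lhs rhs (ℚᵘ.drop-*<* (ℚᵘ.<-respʳ-≃ αⁿ≃ e<αⁿᵘ)))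
    where
    e<αⁿᵘ : mkℚᵘ (+ e) 0 ℚᵘ.< toℚᵘ (α ^ℚ n)
    e<αⁿᵘ = subst (ℚᵘ._< toℚᵘ (α ^ℚ n)) (toℚᵘ-fromℕ e) (ℚ.toℚᵘ-mono-< e<αⁿ)
    αⁿ≃ : toℚᵘ (α ^ℚ n) ℚᵘ.≃ mkℚᵘ (+ a) k ^ᵘ n
    αⁿ≃ = subst (λ p → toℚᵘ (α ^ℚ n) ℚᵘ.≃ p ^ᵘ n) α≡a/b (toℚᵘ-homo-^ α n)
    lhs : + e ℤ.* ↧ (mkℚᵘ (+ a) k ^ᵘ n) ≡ + (e * suc k ^ n)
    lhs = trans (sym (ℤ.pos-* e _)) (cong (λ x → + (e * x)) (↧ₙ-^ᵘ (+ a) k n))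
    rhs : ↥ (mkℚᵘ (+ a) k ^ᵘ n) ℤ.* + 1 ≡ + (a ^ n)
    rhs = trans (ℤ.*-identityʳ _) (↥-^ᵘ a k n)

  ≤½^*fromℕ : ∀ {n m} d → n * 2 ^ d ≤ m → (+ n / 1) ℚ.≤ (½ ^ℚ d) ℚ.* (+ m / 1)
  ≤½^*fromℕ {n} {m} d n*2ᵈ≤m =
    ℚ.toℚᵘ-cancel-≤ (subst (ℚᵘ._≤ _) (sym (toℚᵘ-fromℕ n)) (ℚᵘ.≤-respʳ-≃ (ℚᵘ.≃-sym ½ᵈ*m≃) n≤P*M))
    where
    P = mkℚᵘ (+ 1) 1 ^ᵘ d
    M = mkℚᵘ (+ m) 0
    ½ᵈ*m≃ : toℚᵘ ((½ ^ℚ d) ℚ.* (+ m / 1)) ℚᵘ.≃ P ℚᵘ.* M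
    ½ᵈ*m≃ = ℚᵘ.≃-trans (ℚ.toℚᵘ-homo-* (½ ^ℚ d) (+ m / 1))
                       (ℚᵘ.*-cong (toℚᵘ-homo-^ ½ d) (ℚᵘ.≃-reflexive (toℚᵘ-fromℕ m)))
    lhs : + (n * 2 ^ d) ≡ + n ℤ.* ↧ (P ℚᵘ.* M)
    lhs = begin
      + (n * 2 ^ d)               ≡⟨ cong (λ x → + (n * x)) (ℕ.*-identityʳ (2 ^ d)) ⟨
      + (n * (2 ^ d * 1))         ≡⟨ cong (λ x → + (n * (x * 1))) (↧ₙ-^ᵘ (+ 1) 1 d) ⟨
      + (n * (↧ₙ P * ↧ₙ M))       ≡⟨ cong (λ x → + (n * x)) (↧ₙ-* P M) ⟨
      + (n * ↧ₙ (P ℚᵘ.* M))       ≡⟨ ℤ.pos-* n _ ⟩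
      + n ℤ.* ↧ (P ℚᵘ.* M)        ∎
    rhs : + m ≡ ↥ (P ℚᵘ.* M) ℤ.* + 1
    rhs = sym (begin
      ↥ (P ℚᵘ.* M) ℤ.* + 1        ≡⟨ ℤ.*-identityʳ _ ⟩
      ↥ (P ℚᵘ.* M)                ≡⟨ ↥-* P M ⟩
      ↥ P ℤ.* + m                 ≡⟨ cong (ℤ._* + m) (↥-^ᵘ 1 1 d) ⟩
      + (1 ^ d) ℤ.* + m           ≡⟨ cong (λ x → + x ℤ.* + m) (ℕ.^-zeroˡ d) ⟩
      + 1 ℤ.* + m                 ≡⟨ ℤ.*-identityˡ (+ m) ⟩
      + m                         ∎)
    n≤P*M : mkℚᵘ (+ n) 0 ℚᵘ.≤ P ℚᵘ.* M
    n≤P*M = *≤* (subst₂ ℤ._≤_ lhs rhs (ℤ.+≤+ n*2ᵈ≤m))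

  0<½ : 0ℚ ℚ.< ½
  0<½ = from-yes (0ℚ ℚ.<? ½)

  ½<1 : ½ ℚ.< 1ℚ
  ½<1 = from-yes (½ ℚ.<? 1ℚ)

  numerator-denominator : ∀ {α} → 0ℚ ℚ.≤ α → α ℚ.< + 2 / 1 →
                          ∃ λ a → ∃ λ k → toℚᵘ α ≡ mkℚᵘ (+ a) k × a < 2 * suc k
  numerator-denominator {mkℚ (+ a) k _} _ α<2 =
    a , k , refl ,
    ℤ.drop‿+<+ (subst₂ ℤ._<_ (ℤ.*-identityʳ (+ a)) (sym (ℤ.pos-* 2 (suc k))) (ℚᵘ.drop-*<* (ℚ.toℚᵘ-mono-< α<2)))
  numerator-denominator {mkℚ -[1+ _ ] _ _} 0≤α _ with () ← ℚᵘ.drop-*≤* (ℚ.toℚᵘ-mono-≤ 0≤α)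

open RationalBounds
open Arithmetic using (descriptorBits; #Descriptors≤2^descriptorBits; descriptorBits≤2^d′; K*n*t^n≤[1+t]^n-eventually)

-- At most 2(a/b)^d exceptions: fewer than (a/b)^d on each of the two parity classes.
maxExceptions : ℕ → ℕ → ℕ → ℕ
maxExceptions a k d = ℕ._/_ (2 ℕ.* a ℕ.^ d) (suc k ℕ.^ d) {{ℕ.m^n≢0 (suc k) d}}

mostlyConstant-within : ∀ {α a k d} → toℚᵘ α ≡ mkℚᵘ (+ a) k → ∀ f → InBEO α d f →
                        MostlyConstantWithin d (maxExceptions a k d) f
mostlyConstant-within {α} {a} {k} {d} α≡a/b f (f∈A , (cE , smallE) , (cO , smallO)) =
  record { ∈A = f∈A ; cE = cE ; cO = cO ; few = ≤-/ (begin
    (exceptE d f cE ℕ.+ exceptO d f cO) ℕ.* bᵈ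
      ≡⟨ ℕ.*-distribʳ-+ bᵈ (exceptE d f cE) _ ⟩
    exceptE d f cE ℕ.* bᵈ ℕ.+ exceptO d f cO ℕ.* bᵈ
      ≤⟨ ℕ.+-mono-≤ (ℕ.<⇒≤ (fromℕ<^⇒ {e = exceptE d f cE} d α≡a/b smallE))
                    (ℕ.<⇒≤ (fromℕ<^⇒ {e = exceptO d f cO} d α≡a/b smallO)) ⟩
    a ℕ.^ d ℕ.+ a ℕ.^ d
      ≡⟨ cong (a ℕ.^ d ℕ.+_) (ℕ.+-identityʳ (a ℕ.^ d)) ⟨
    2 ℕ.* a ℕ.^ d ∎) }
  where
  open ℕ.≤-Reasoning
  bᵈ = suc k ℕ.^ d
  instance
    bᵈ≢0 : ℕ.NonZero bᵈ
    bᵈ≢0 = ℕ.m^n≢0 (suc k) d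
  ≤-/ : ∀ {x y} → x ℕ.* bᵈ ≤ y → x ≤ y ℕ./ bᵈ
  ≤-/ {x} x*bᵈ≤y = subst (_≤ _) (m*n/n≡m x bᵈ) (/-monoˡ-≤ bᵈ x*bᵈ≤y)

mostlyConstantClasses*2^d≤classes : ∀ {α a k d′ n m} → let d = suc d′; t = suc (2 ℕ.* k) in
  toℚᵘ α ≡ mkℚᵘ (+ a) k → a < 2 ℕ.* suc k → 22 ℕ.* d ℕ.* t ℕ.^ d ≤ suc t ℕ.^ d →
  NumClasses d (InBEO α d) n → NumClasses d (InB d) m → n ℕ.* 2 ℕ.^ d ≤ m
mostlyConstantClasses*2^d≤classes {α} {a} {k} {d′} {n} {m} α≡a/b a<2b growth mostlyConstant all = begin
  n ℕ.* 2 ℕ.^ suc d′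
    ≤⟨ ℕ.*-monoˡ-≤ _ (numClasses≤#Descriptors L mostlyConstant (mostlyConstant-within α≡a/b)) ⟩
  #Descriptors (suc d′) L ℕ.* 2 ℕ.^ suc d′
    ≤⟨ ℕ.*-monoˡ-≤ _ (#Descriptors≤2^descriptorBits (suc d′) L) ⟩
  2 ℕ.^ descriptorBits (suc d′) L ℕ.* 2 ℕ.^ suc d′
    ≡⟨ ℕ.^-distribˡ-+-* 2 (descriptorBits (suc d′) L) (suc d′) ⟨
  2 ℕ.^ (descriptorBits (suc d′) L ℕ.+ suc d′)
    ≤⟨ ℕ.^-monoʳ-≤ 2 (descriptorBits≤2^d′ d′ a<2b L*bᵈ≤2aᵈ growth) ⟩
  2 ℕ.^ (2 ℕ.^ d′)
    ≤⟨ 2^2^d≤numClasses all ⟩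
  m ∎
  where
  open ℕ.≤-Reasoning
  L = maxExceptions a k (suc d′)
  L*bᵈ≤2aᵈ : L ℕ.* suc k ℕ.^ suc d′ ≤ 2 ℕ.* a ℕ.^ suc d′
  L*bᵈ≤2aᵈ = m/n*n≤m (2 ℕ.* a ℕ.^ suc d′) (suc k ℕ.^ suc d′) {{ℕ.m^n≢0 (suc k) (suc d′)}}

lemma2p1 : (α : ℚ) → 0ℚ ℚ.≤ α → α ℚ.< (+ 2 / 1) →
    ∃ λ (q : ℚ) → (0ℚ ℚ.< q) × (q ℚ.< 1ℚ) × (∃ λ (d₀ : ℕ) →
    ∀ (d : ℕ) → d ℕ.≥ d₀ → ∀ (n m : ℕ) →
    NumClasses d (InBEO α d) n → NumClasses d (InB d) m →
    (+ n / 1) ℚ.≤ ((q ^ℚ d) ℚ.* (+ m / 1)))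
lemma2p1 α 0≤α α<2
  with a , k , α≡a/b , a<2b ← numerator-denominator 0≤α α<2
  with n₀ , growth ← K*n*t^n≤[1+t]^n-eventually 22 (suc (2 ℕ.* k)) (s≤s z≤n) =
  ½ , 0<½ , ½<1 , suc n₀ , bound
  where
  bound : ∀ d → d ℕ.≥ suc n₀ → ∀ n m → NumClasses d (InBEO α d) n → NumClasses d (InB d) m →
          (+ n / 1) ℚ.≤ ((½ ^ℚ d) ℚ.* (+ m / 1))
  bound d@(suc d′) (s≤s n₀≤d′) n m mostlyConstant all = ≤½^*fromℕ {n} {m} d
    (mostlyConstantClasses*2^d≤classes α≡a/b a<2b (growth d (ℕ.m≤n⇒m≤1+n n₀≤d′)) mostlyConstant all)
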